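{- Under the standing assumptions in the context, let $\Gamma$ be a graph and $U\subseteq V(\Gamma)$. Let $X\subseteq V(H)$ be a signature of $H$ and let $f:X\to V(\Gamma)$ be a function. Then the number of embeddings $\theta:H\hookrightarrow\Gamma$ with $\theta(v)=f(v)$ for all $v\in X$ and $\theta(v)\in U$ for all $v\in V(H)\setminus X$ is at most $\operatorname{E}_{k-|X|}(|U|)$.
   Context: Standing assumptions: $\log$ is the natural logarithm; $\widetilde H=\mathrm{Cayley}(G,\Lambda)$ is a Cayley graph of an abelian group $G$ of order $\tilde k\ge10^{200}$ (vertex set $G$, distinct $x,y$ adjacent iff $x-y\in\Lambda$); $H$ is a $(q,\delta)$-reasonable induced subgraph of $\widetilde H$ on $k\ge\tilde k-\frac14\log\tilde k$ vertices with $10^{ -20}\ge q\ge10^4(\log k)^{6/5}k^{ -1/5}$, $\delta\ge10^3(\log k)^{1/5}k^{ -1/5}$, $\delta>10^{ -2}q/\log(1/q)$, where $(q,\delta)$-reasonable means: (a) $H$ is prime (no $U'\subseteq V(H)$ with $2\le|U'|<k$ such that every vertex outside $U'$ is adjacent to all or none of $U'$); (b) for any distinct $v,w\in V(\widetilde H)$, at least $qk$ vertices of $V(H)\setminus\{v,w\}$ are adjacent to exactly one of $v,w$; (c) every injective adjacency-preserving (on distinct pairs) $f:X\to V(\widetilde H)$ with $X\subseteq V(\widetilde H)$, $|X|\ge(1-\delta)k$, is the restriction of a rotation $x\mapsto x+g$ or reflection $x\mapsto-x+g$. A signature of $H$ is a set $S\subseteq V(H)$ with $N(v)\cap S\ne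 N(w)\cap S$ for all distinct $v,w\in V(H)\setminus S$ ($N$ = neighbourhood in $H$). An embedding $H\hookrightarrow\Gamma$ is an injective map $V(H)\to V(\Gamma)$ sending edges to edges and non-edges to non-edges. For integers $\ell\ge1$, $m\ge0$, $\operatorname{E}_\ell(m)=m_1\cdots m_\ell$ where $m_1+\dots+m_\ell=m$ and $\lceil m/\ell\rceil\ge m_1\ge\dots\ge m_\ell\ge\lfloor m/\ell\rfloor$ are non-negative integers. -}

module Defs where

open import Data.Nat using (ℕ; zero; suc; _*_; _∸_; _^_)
open import Data.Nat.DivMod using (_/_; _%_)
open import Data.Bool using (Bool; false)
open import Data.Fin using (Fin)
open import Data.Fin.Subset using (Subset; _∈_; _∉_)
open import Data.Product using (_×_)
open import Relation.Nullary using (¬_)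
open import Relation.Binary.PropositionalEquality using (_≡_; _≢_)

record Graph (n : ℕ) : Set where
  field
    adj    : Fin n → Fin n → Bool
    sym    : ∀ x y → adj x y ≡ adj y x
    irrefl : ∀ x → adj x x ≡ false
open Graph public

IsSignature : ∀ {k} → Graph k → Subset k → Set
IsSignature {k} H S =
  ∀ (v w : Fin k) → v ∉ S → w ∉ S → v ≢ w →
  ¬ (∀ x → x ∈ S → adj H v x ≡ adj H w x)

IsEmbedding : ∀ {k n} → Graph k → Graph n → (Fin k → Fin n) → Set
IsEmbedding {k} H Γ θ =
  (∀ (u v : Fin k) → θ u ≡ θ v → u ≡ v) ×
  (∀ (u v : Fin k) → u ≢ v → adj H u v ≡ adj Γ (θ u) (θ v))

-- E ℓ m = m₁⋯m_ℓ for the balanced partition m = m₁+⋯+m_ℓ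
-- (r = m mod ℓ parts equal ⌊m/ℓ⌋+1, the other ℓ−r parts equal ⌊m/ℓ⌋).
-- For ℓ = 0 we use the empty product 1.
E : ℕ → ℕ → ℕ
E zero    m = 1
E (suc l) m = suc (m / suc l) ^ (m % suc l) * (m / suc l) ^ (suc l ∸ m % suc l)

module Submission where

-- Call u ∈ V(Γ) a candidate for a vertex v ∉ X if the Γ-adjacencies of u to
-- f(X) agree with the H-adjacencies of v to X.  An embedding θ extending f sends
-- each v ∉ X to a candidate for v and is determined by these values, so the
-- embeddings in question inject into ∏_{v ∉ X} A_v, where A_v is the list of
-- candidates for v inside U.  As X is a signature, distinct v, w ∉ X share no
-- candidate, so the A_v are disjoint and ∑ |A_v| ≤ |U|.  A product of k − |X|
-- naturals with sum at most |U| is at most the balanced product E (k − |X|) |U|.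

open import Defs using (Graph; adj; IsSignature; IsEmbedding; E)
open import Data.Nat using (ℕ; zero; suc; _+_; _*_; _^_; _≤_; _∸_; z≤n; s≤s; NonZero)
open import Data.Nat.Properties
open import Data.Nat.DivMod using (_/_; _%_; m≡m%n+[m/n]*n; m%n<n; m≥n⇒m/n>0)
open import Data.Nat.ListAction using (sum; product)
open import Data.Nat.Solver using (module +-*-Solver)
open import Data.Bool using () renaming (_≟_ to _≟ᵇ_)
open import Data.Fin as Fin using (Fin; zero; suc; combine) renaming (_≟_ to _≟ᶠ_)
open import Data.Fin.Properties using (injective⇒≤; combine-injective; all?) renaming (suc-injective to Fin-suc-injective)
open import Data.Fin.Subset using (Subset; _∈_; _∉_; ∣_∣; ∁; inside; outside)
open import Data.Fin.Subset.Properties using (_∈?_; ∣∁p∣≡n∸∣p∣; x∈∁p⇒x∉p; x∉p⇒x∈∁p)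
open import Data.Vec using (Vec; []; _∷_; here; there; tabulate; lookup)
open import Data.Vec.Properties using (tabulate∘lookup; tabulate-cong)
open import Data.Vec.Properties.WithK using ([]=-irrelevant)
open import Data.List as List using (List; []; _∷_; length; map; filter; concat)
open import Data.List.Properties using (length-map; length-++; map-∘)
open import Data.List.Membership.Propositional using () renaming (_∈_ to _∈ₗ_)
open import Data.List.Membership.Propositional.Properties
  using (∈-lookup; ∈-map⁺; ∈-map⁻; ∈-concat⁻′; ∈-filter⁺; ∈-filter⁻)
open import Data.List.Membership.Setoid.Properties using (index-injective)
open import Data.List.Relation.Binary.Subset.Propositional using (_⊆_)
open import Data.List.Relation.Binary.Disjoint.Propositional using (Disjoint)
open import Data.List.Relation.Unary.Any using (here; there; index)
open import Data.List.Relation.Unary.All as All using (All; []; _∷_)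
import Data.List.Relation.Unary.All.Properties as All
open import Data.List.Relation.Unary.AllPairs as AllPairs using (AllPairs; []; _∷_)
import Data.List.Relation.Unary.AllPairs.Properties as AllPairs
open import Data.List.Relation.Unary.Unique.Propositional using (Unique)
import Data.List.Relation.Unary.Unique.Propositional.Properties as Unique
open import Data.Product using (_×_; _,_; proj₁; proj₂)
open import Data.Sum using (inj₁; inj₂)
open import Function using (_∘_)
open import Relation.Nullary using (¬_; Dec; yes; no; ¬?; contradiction)
open import Relation.Nullary.Decidable using (_×-dec_)
open import Relation.Binary.PropositionalEquality
  using (_≡_; _≢_; refl; sym; trans; cong; cong₂; subst; setoid; module ≡-Reasoning)

open +-*-Solver using (solve; _:*_; _:+_; con; _:=_)

-- Bernoulli above the peak: (1 + 1/q)^d ≥ 1 + d/q, cleared of denominators.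
bernoulli-above : ∀ q d → (q + d) * q ^ d ≤ q * suc q ^ d
bernoulli-above q zero = ≤-reflexive (cong (_* 1) (+-identityʳ q))
bernoulli-above q (suc d) rewrite +-suc q d = begin
    suc (q + d) * (q * Z)   ≡⟨ solve 3 (λ x y z → (con 1 :+ x) :* (y :* z) := y :* (z :+ x :* z))
                                       refl (q + d) q Z ⟩
    q * (Z + (q + d) * Z)   ≤⟨ *-monoʳ-≤ q (+-mono-≤ (^-monoˡ-≤ d (n≤1+n q)) (bernoulli-above q d)) ⟩
    q * (W + q * W)         ∎
  where
  open ≤-Reasoning
  Z : ℕ
  Z = q ^ d
  W : ℕ
  W = suc q ^ d

-- Bernoulli below the peak: for q = a + s, a/q ≤ (q/(q+1))^s, cleared of denominators.
bernoulli-below : ∀ s a → a * suc (a + s) ^ s ≤ (a + s) ^ suc s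
bernoulli-below zero a = ≤-reflexive (cong (_* 1) (sym (+-identityʳ a)))
bernoulli-below (suc s) a rewrite +-suc a s = begin
    a * (suc (suc t) * Y)   ≡⟨ sym (*-assoc a (suc (suc t)) Y) ⟩
    (a * suc (suc t)) * Y   ≤⟨ *-monoˡ-≤ Y shift ⟩
    (suc a * suc t) * Y     ≡⟨ solve 3 (λ x y z → (x :* y) :* z := y :* (x :* z)) refl (suc a) (suc t) Y ⟩
    suc t * (suc a * Y)     ≤⟨ *-monoʳ-≤ (suc t) (bernoulli-below s (suc a)) ⟩
    suc t * (suc t ^ suc s) ∎
  where
  open ≤-Reasoning
  t : ℕ
  t = a + s
  Y : ℕ
  Y = suc (suc t) ^ s
  shift : a * suc (suc t) ≤ suc a * suc t
  shift = begin
    a * suc (suc t)     ≡⟨ *-suc a (suc t) ⟩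
    a + a * suc t       ≤⟨ +-monoˡ-≤ (a * suc t) (≤-trans (m≤m+n a s) (n≤1+n t)) ⟩
    suc t + a * suc t   ∎

-- The weight a ↦ a·(q/(q+1))^a on ℕ is maximal at a = q:
-- a · q^a · (q+1)^q ≤ q^(q+1) · (q+1)^a.
Peak : ℕ → ℕ → Set
Peak a q = a * q ^ a * suc q ^ q ≤ q ^ suc q * suc q ^ a

peak-above : ∀ q d → Peak (q + d) q
peak-above q d = begin
    (q + d) * q ^ (q + d) * suc q ^ q          ≡⟨ cong (λ z → (q + d) * z * suc q ^ q) (^-distribˡ-+-* q q d) ⟩
    (q + d) * (q ^ q * q ^ d) * suc q ^ q      ≡⟨ solve 4 (λ x y z w → x :* (y :* z) :* w := (x :* z) :* (y :* w))
                                                        refl (q + d) (q ^ q) (q ^ d) (suc q ^ q) ⟩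
    ((q + d) * q ^ d) * (q ^ q * suc q ^ q)    ≤⟨ *-monoˡ-≤ _ (bernoulli-above q d) ⟩
    (q * suc q ^ d) * (q ^ q * suc q ^ q)      ≡⟨ solve 4 (λ x y z w → (x :* y) :* (z :* w) := (x :* z) :* (w :* y))
                                                        refl q (suc q ^ d) (q ^ q) (suc q ^ q) ⟩
    (q * q ^ q) * (suc q ^ q * suc q ^ d)      ≡⟨ cong ((q * q ^ q) *_) (sym (^-distribˡ-+-* (suc q) q d)) ⟩
    q ^ suc q * suc q ^ (q + d)                ∎
  where open ≤-Reasoning

peak-below : ∀ a s → Peak a (a + s)
peak-below a s = begin
    a * q ^ a * suc q ^ (a + s)              ≡⟨ cong (λ z → a * q ^ a * z) (^-distribˡ-+-* (suc q) a s) ⟩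
    a * q ^ a * (suc q ^ a * suc q ^ s)      ≡⟨ solve 4 (λ x y z w → x :* y :* (z :* w) := (x :* w) :* (y :* z))
                                                      refl a (q ^ a) (suc q ^ a) (suc q ^ s) ⟩
    (a * suc q ^ s) * (q ^ a * suc q ^ a)    ≤⟨ *-monoˡ-≤ _ (bernoulli-below s a) ⟩
    (q * q ^ s) * (q ^ a * suc q ^ a)        ≡⟨ solve 4 (λ x y z w → (x :* y) :* (z :* w) := (x :* (z :* y)) :* w)
                                                      refl q (q ^ s) (q ^ a) (suc q ^ a) ⟩
    q * (q ^ a * q ^ s) * suc q ^ a          ≡⟨ cong (λ z → q * z * suc q ^ a) (sym (^-distribˡ-+-* q a s)) ⟩
    q ^ suc q * suc q ^ a                    ∎
  where
  open ≤-Reasoning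
  q : ℕ
  q = a + s

peak : ∀ a q → Peak a q
peak a q with ≤-total q a
... | inj₁ q≤a = subst (λ z → Peak z q) (m+[n∸m]≡n q≤a) (peak-above q (a ∸ q))
... | inj₂ a≤q = subst (Peak a) (m+[n∸m]≡n a≤q) (peak-below a (q ∸ a))
weighted-product : ∀ q (as : List ℕ) →
  product as * q ^ sum as * suc q ^ (q * length as) ≤ q ^ (suc q * length as) * suc q ^ sum as
weighted-product q [] rewrite *-zeroʳ q = ≤-refl
weighted-product q (a ∷ as) = begin
    a * P * q ^ (a + S) * suc q ^ (q * suc L)            ≡⟨ cong₂ (λ x y → a * P * x * suc q ^ y)
                                                                 (^-distribˡ-+-* q a S) (*-suc q L) ⟩
    a * P * (q ^ a * q ^ S) * suc q ^ (q + q * L)        ≡⟨ cong (a * P * (q ^ a * q ^ S) *_)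
                                                                 (^-distribˡ-+-* (suc q) q (q * L)) ⟩
    a * P * (q ^ a * q ^ S) * (suc q ^ q * suc q ^ (q * L))
      ≡⟨ solve 6 (λ a P x y z w → a :* P :* (x :* y) :* (z :* w) := (a :* x :* z) :* (P :* y :* w))
               refl a P (q ^ a) (q ^ S) (suc q ^ q) (suc q ^ (q * L)) ⟩
    (a * q ^ a * suc q ^ q) * (P * q ^ S * suc q ^ (q * L))
      ≤⟨ *-mono-≤ (peak a q) (weighted-product q as) ⟩
    (q ^ suc q * suc q ^ a) * (q ^ (suc q * L) * suc q ^ S)
      ≡⟨ solve 4 (λ x y z w → (x :* y) :* (z :* w) := (x :* z) :* (y :* w))
               refl (q ^ suc q) (suc q ^ a) (q ^ (suc q * L)) (suc q ^ S) ⟩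
    q ^ suc q * q ^ (suc q * L) * (suc q ^ a * suc q ^ S) ≡⟨ cong₂ _*_ (sym (^-distribˡ-+-* q (suc q) (suc q * L)))
                                                                       (sym (^-distribˡ-+-* (suc q) a S)) ⟩
    q ^ (suc q + suc q * L) * suc q ^ (a + S)             ≡⟨ cong (λ y → q ^ y * suc q ^ (a + S)) (sym (*-suc (suc q) L)) ⟩
    q ^ (suc q * suc L) * suc q ^ (a + S)                 ∎
  where
  open ≤-Reasoning
  L : ℕ
  L = length as
  P : ℕ
  P = product as
  S : ℕ
  S = sum as

length≤sum : ∀ (as : List ℕ) → product as ≢ 0 → length as ≤ sum as
length≤sum [] _ = z≤n
length≤sum (zero ∷ as) ∏≢0 = contradiction refl ∏≢0
length≤sum (suc a ∷ as) ∏≢0 =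
  s≤s (≤-trans (length≤sum as (λ ∏≡0 → ∏≢0 (trans (cong (suc a *_) ∏≡0) (*-zeroʳ (suc a)))))
               (m≤n+m (sum as) a))

-- The balanced bound with positive base q+1: if ∑ as ≤ r + (q+1)·L and r + e = L,
-- then ∏ as ≤ (q+2)^r · (q+1)^e.  Cancel q^S·(q+2)^((q+1)L) from the weighted product.
product≤balanced : ∀ q' (as : List ℕ) r e →
  sum as ≤ r + suc q' * length as → r + e ≡ length as → product as ≤ suc (suc q') ^ r * suc q' ^ e
product≤balanced q' as r e S≤m r+e≡L =
  *-cancelʳ-≤ (product as) (sq ^ r * q ^ e) (q ^ S * sq ^ (q * L)) {{cancel-nonzero}} chain
  where
  open ≤-Reasoning
  q : ℕ
  q = suc q'
  sq : ℕ
  sq = suc q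
  S : ℕ
  S = sum as
  L : ℕ
  L = length as
  d : ℕ
  d = r + q * L ∸ S
  S+d≡m : S + d ≡ r + q * L
  S+d≡m = m+[n∸m]≡n S≤m
  cancel-nonzero : NonZero (q ^ S * sq ^ (q * L))
  cancel-nonzero = m*n≢0 (q ^ S) (sq ^ (q * L)) {{m^n≢0 q S}} {{m^n≢0 sq (q * L)}}
  exponent : sq * L ≡ S + d + e
  exponent = begin-equality
    L + q * L           ≡⟨ cong (_+ q * L) (sym r+e≡L) ⟩
    r + e + q * L       ≡⟨ solve 3 (λ r e y → r :+ e :+ y := r :+ y :+ e) refl r e (q * L) ⟩
    r + q * L + e       ≡⟨ cong (_+ e) (sym S+d≡m) ⟩
    S + d + e           ∎
  chain : product as * (q ^ S * sq ^ (q * L)) ≤ (sq ^ r * q ^ e) * (q ^ S * sq ^ (q * L))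
  chain = begin
    product as * (q ^ S * sq ^ (q * L))     ≡⟨ sym (*-assoc (product as) _ _) ⟩
    product as * q ^ S * sq ^ (q * L)       ≤⟨ weighted-product q as ⟩
    q ^ (sq * L) * sq ^ S                   ≡⟨ cong (λ y → q ^ y * sq ^ S) exponent ⟩
    q ^ (S + d + e) * sq ^ S                ≡⟨ cong (_* sq ^ S) (trans (^-distribˡ-+-* q (S + d) e)
                                                                      (cong (_* q ^ e) (^-distribˡ-+-* q S d))) ⟩
    q ^ S * q ^ d * q ^ e * sq ^ S          ≤⟨ *-monoˡ-≤ (sq ^ S) (*-monoˡ-≤ (q ^ e)
                                                 (*-monoʳ-≤ (q ^ S) (^-monoˡ-≤ d (n≤1+n q)))) ⟩
    q ^ S * sq ^ d * q ^ e * sq ^ S         ≡⟨ solve 4 (λ a b c x → a :* b :* c :* x := c :* a :* (x :* b))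
                                                      refl (q ^ S) (sq ^ d) (q ^ e) (sq ^ S) ⟩
    q ^ e * q ^ S * (sq ^ S * sq ^ d)       ≡⟨ cong (q ^ e * q ^ S *_) (sym (^-distribˡ-+-* sq S d)) ⟩
    q ^ e * q ^ S * sq ^ (S + d)            ≡⟨ cong (λ y → q ^ e * q ^ S * sq ^ y) S+d≡m ⟩
    q ^ e * q ^ S * sq ^ (r + q * L)        ≡⟨ cong (q ^ e * q ^ S *_) (^-distribˡ-+-* sq r (q * L)) ⟩
    q ^ e * q ^ S * (sq ^ r * sq ^ (q * L)) ≡⟨ solve 4 (λ a b c x → a :* b :* (c :* x) := c :* a :* (b :* x))
                                                      refl (q ^ e) (q ^ S) (sq ^ r) (sq ^ (q * L)) ⟩
    sq ^ r * q ^ e * (q ^ S * sq ^ (q * L)) ∎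

-- Discrete AM–GM: a product of L naturals with sum at most m is at most E L m.
-- A zero factor makes this trivial; otherwise L ≤ m, so the quotient m / L is positive.
product≤E : ∀ (as : List ℕ) m → sum as ≤ m → product as ≤ E (length as) m
product≤E [] m _ = ≤-refl
product≤E as@(_ ∷ _) m S≤m with product as ≟ 0
... | yes ∏≡0 = ≤-trans (≤-reflexive ∏≡0) z≤n
... | no ∏≢0 with m / length as | m≥n⇒m/n>0 {m} {length as} (≤-trans (length≤sum as ∏≢0) S≤m)
                                | m≡m%n+[m/n]*n m (length as)
...   | zero    | ()  | _
...   | suc q'  | _   | m≡r+qL =
  product≤balanced q' as (m % length as) (length as ∸ m % length as)
    (≤-trans S≤m (≤-reflexive m≡r+qL))
    (m+[n∸m]≡n (<⇒≤ (m%n<n m (length as))))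

lookup-injective : ∀ {A : Set} {xs : List A} → Unique xs →
  ∀ i j → List.lookup xs i ≡ List.lookup xs j → i ≡ j
lookup-injective (_ ∷ _) zero zero _ = refl
lookup-injective (x≢xs ∷ _) zero (suc j) x≡xsⱼ = contradiction x≡xsⱼ (All.lookup x≢xs (∈-lookup j))
lookup-injective (x≢xs ∷ _) (suc i) zero xsᵢ≡x = contradiction (sym xsᵢ≡x) (All.lookup x≢xs (∈-lookup i))
lookup-injective (_ ∷ xs-unique) (suc i) (suc j) eq = cong suc (lookup-injective xs-unique i j eq)

codable⇒length≤ : ∀ {A : Set} {M} {xs : List A} → Unique xs →
  (code : ∀ {x} → x ∈ₗ xs → Fin M) →
  (∀ {x y} (x∈ : x ∈ₗ xs) (y∈ : y ∈ₗ xs) → code x∈ ≡ code y∈ → x ≡ y) →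
  length xs ≤ M
codable⇒length≤ {xs = xs} xs-unique code faithful =
  injective⇒≤ {f = λ i → code (∈-lookup i)}
    (λ {i} {j} eq → lookup-injective xs-unique i j (faithful (∈-lookup i) (∈-lookup j) eq))

unique-⊆⇒length≤ : ∀ {A : Set} {xs ys : List A} → Unique xs → xs ⊆ ys → length xs ≤ length ys
unique-⊆⇒length≤ {A = A} xs-unique xs⊆ys =
  codable⇒length≤ xs-unique (index ∘ xs⊆ys) (λ x∈ y∈ → index-injective (setoid A) (xs⊆ys x∈) (xs⊆ys y∈))

length-concat : ∀ {A : Set} (xss : List (List A)) → length (concat xss) ≡ sum (map length xss)
length-concat [] = refl
length-concat (xs ∷ xss) = trans (length-++ xs) (cong (length xs +_) (length-concat xss))

disjoint-sublists-bound : ∀ {A : Set} {ys : List A} (xss : List (List A)) →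
  All Unique xss → AllPairs Disjoint xss → All (_⊆ ys) xss → sum (map length xss) ≤ length ys
disjoint-sublists-bound xss uniques disjoint sublists =
  subst (_≤ _) (length-concat xss) (unique-⊆⇒length≤ (Unique.concat⁺ uniques disjoint) concat⊆)
  where
  concat⊆ : concat xss ⊆ _
  concat⊆ x∈ with ∈-concat⁻′ xss x∈
  ... | xs , x∈xs , xs∈xss = All.lookup sublists xs∈xss x∈xs

-- Mixed-radix coding: a choice of g i ∈ A i for each i in Is is coded as a number
-- below ∏ |A i|, and the code determines the choice.
encode : ∀ {I C : Set} (A : I → List C) (g : I → C) (Is : List I) →
  All (λ i → g i ∈ₗ A i) Is → Fin (product (map (length ∘ A) Is))
encode A g [] [] = zero
encode A g (i ∷ Is) (gi∈ ∷ g∈) = combine (index gi∈) (encode A g Is g∈)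

encode-injective : ∀ {I C : Set} (A : I → List C) (g g′ : I → C) (Is : List I)
  (g∈ : All (λ i → g i ∈ₗ A i) Is) (g′∈ : All (λ i → g′ i ∈ₗ A i) Is) →
  encode A g Is g∈ ≡ encode A g′ Is g′∈ → All (λ i → g i ≡ g′ i) Is
encode-injective A g g′ [] [] [] _ = []
encode-injective {C = C} A g g′ (i ∷ Is) (gi∈ ∷ g∈) (g′i∈ ∷ g′∈) eq
  with combine-injective (index gi∈) (encode A g Is g∈) (index g′i∈) (encode A g′ Is g′∈) eq
... | same-index , same-rest =
  index-injective (setoid C) gi∈ g′i∈ same-index ∷ encode-injective A g g′ Is g∈ g′∈ same-rest

members : ∀ {n} → Subset n → List (Fin n)
members [] = []
members (inside ∷ p) = zero ∷ map suc (members p)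
members (outside ∷ p) = map suc (members p)

members-length : ∀ {n} (p : Subset n) → length (members p) ≡ ∣ p ∣
members-length [] = refl
members-length (inside ∷ p) = cong suc (trans (length-map suc (members p)) (members-length p))
members-length (outside ∷ p) = trans (length-map suc (members p)) (members-length p)

members⁺ : ∀ {n} {p : Subset n} {x} → x ∈ p → x ∈ₗ members p
members⁺ {p = inside ∷ p} here = here refl
members⁺ {p = inside ∷ p} (there x∈p) = there (∈-map⁺ suc (members⁺ x∈p))
members⁺ {p = outside ∷ p} (there x∈p) = ∈-map⁺ suc (members⁺ x∈p)

∈-map-suc⁻ : ∀ {n} {x : Fin n} {xs} → suc x ∈ₗ map suc xs → x ∈ₗ xs
∈-map-suc⁻ suc-x∈ with ∈-map⁻ Fin.suc suc-x∈
... | _ , y∈ , refl = y∈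

zero∉map-suc : ∀ {n} {xs : List (Fin n)} → ¬ (zero ∈ₗ map suc xs)
zero∉map-suc zero∈ with ∈-map⁻ Fin.suc zero∈
... | _ , _ , ()

members⁻ : ∀ {n} {p : Subset n} {x} → x ∈ₗ members p → x ∈ p
members⁻ {p = inside ∷ p} {zero} _ = here
members⁻ {p = outside ∷ p} {zero} zero∈ = contradiction zero∈ zero∉map-suc
members⁻ {p = inside ∷ p} {suc x} (here ())
members⁻ {p = inside ∷ p} {suc x} (there suc-x∈) = there (members⁻ (∈-map-suc⁻ suc-x∈))
members⁻ {p = outside ∷ p} {suc x} suc-x∈ = there (members⁻ (∈-map-suc⁻ suc-x∈))

members-unique : ∀ {n} (p : Subset n) → Unique (members p)
members-unique [] = []
members-unique (inside ∷ p) =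
  All.tabulate (λ y∈ zero≡y → zero∉map-suc (subst (_∈ₗ _) (sym zero≡y) y∈))
  ∷ Unique.map⁺ Fin-suc-injective (members-unique p)
members-unique (outside ∷ p) = Unique.map⁺ Fin-suc-injective (members-unique p)

lookup-extensional : ∀ {A : Set} {k} (θ θ′ : Vec A k) → (∀ i → lookup θ i ≡ lookup θ′ i) → θ ≡ θ′
lookup-extensional θ θ′ same = begin
  θ                    ≡⟨ sym (tabulate∘lookup θ) ⟩
  tabulate (lookup θ)  ≡⟨ tabulate-cong same ⟩
  tabulate (lookup θ′) ≡⟨ tabulate∘lookup θ′ ⟩
  θ′                   ∎
  where open ≡-Reasoning

module Candidates {k n} (H : Graph k) (Γ : Graph n) (X : Subset k) (f : (v : Fin k) → v ∈ X → Fin n) where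

  Candidate : Fin k → Fin n → Set
  Candidate v u = v ∉ X × (∀ x (x∈X : x ∈ X) → adj Γ u (f x x∈X) ≡ adj H v x)

  candidate? : ∀ v u → Dec (Candidate v u)
  candidate? v u = ¬? (v ∈? X) ×-dec all? agrees?
    where
    -- f x x∈X does not depend on the membership proof x∈X, so one test decides all.
    agrees? : ∀ x → Dec (∀ (x∈X : x ∈ X) → adj Γ u (f x x∈X) ≡ adj H v x)
    agrees? x with x ∈? X
    ... | no x∉X = yes (λ x∈X → contradiction x∈X x∉X)
    ... | yes x∈X with adj Γ u (f x x∈X) ≟ᵇ adj H v x
    ...   | yes agree = yes (λ x∈X′ → subst (λ p → adj Γ u (f x p) ≡ adj H v x) ([]=-irrelevant x∈X x∈X′) agree)
    ...   | no disagree = no (λ agree → disagree (agree x∈X))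

  candidate-unique : IsSignature H X → ∀ {v w u} → Candidate v u → Candidate w u → v ≡ w
  candidate-unique signature {v} {w} (v∉X , v-agrees) (w∉X , w-agrees) with v ≟ᶠ w
  ... | yes v≡w = v≡w
  ... | no v≢w = contradiction (λ x x∈X → trans (sym (v-agrees x x∈X)) (w-agrees x x∈X))
                               (signature v w v∉X w∉X v≢w)

  embedding-candidate : ∀ {θ : Fin k → Fin n} → IsEmbedding H Γ θ → (∀ x (x∈X : x ∈ X) → θ x ≡ f x x∈X) →
    ∀ {v} → v ∉ X → Candidate v (θ v)
  embedding-candidate {θ} (_ , preserves) extends {v} v∉X = v∉X , agrees
    where
    agrees : ∀ x (x∈X : x ∈ X) → adj Γ (θ v) (f x x∈X) ≡ adj H v x
    agrees x x∈X = begin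
      adj Γ (θ v) (f x x∈X) ≡⟨ cong (adj Γ (θ v)) (sym (extends x x∈X)) ⟩
      adj Γ (θ v) (θ x)     ≡⟨ sym (preserves v x (λ { refl → v∉X x∈X })) ⟩
      adj H v x             ∎
      where open ≡-Reasoning

  free : List (Fin k)
  free = members (∁ X)

  free-length : length free ≡ k ∸ ∣ X ∣
  free-length = trans (members-length (∁ X)) (∣∁p∣≡n∸∣p∣ X)

  candidates : Subset n → Fin k → List (Fin n)
  candidates U v = filter (candidate? v) (members U)

  candidates⁻ : ∀ U {v u} → u ∈ₗ candidates U v → u ∈ₗ members U × Candidate v u
  candidates⁻ U {v} = ∈-filter⁻ (candidate? v) {xs = members U}

  -- The candidate lists of the free vertices are disjoint sublists of U.
  candidates-total : IsSignature H X → ∀ U → sum (map (length ∘ candidates U) free) ≤ ∣ U ∣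
  candidates-total signature U = begin
    sum (map (length ∘ candidates U) free)        ≡⟨ cong sum (map-∘ free) ⟩
    sum (map length (map (candidates U) free))    ≤⟨ disjoint-sublists-bound {ys = members U} (map (candidates U) free)
                                                       (All.map⁺ (All.tabulate (λ _ → Unique.filter⁺ (candidate? _) (members-unique U))))
                                                       (AllPairs.map⁺ (AllPairs.map disjoint (members-unique (∁ X))))
                                                       (All.map⁺ (All.tabulate (λ _ → proj₁ ∘ candidates⁻ U))) ⟩
    length (members U)                            ≡⟨ members-length U ⟩
    ∣ U ∣                                         ∎
    where
    open ≤-Reasoning
    disjoint : ∀ {v w} → v ≢ w → Disjoint (candidates U v) (candidates U w)
    disjoint v≢w (u∈v , u∈w) =
      v≢w (candidate-unique signature (proj₂ (candidates⁻ U u∈v)) (proj₂ (candidates⁻ U u∈w)))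

  Extension : Subset n → Vec (Fin n) k → Set
  Extension U θ = IsEmbedding H Γ (lookup θ)
                × (∀ (v : Fin k) (p : v ∈ X) → lookup θ v ≡ f v p)
                × (∀ (v : Fin k) → v ∉ X → lookup θ v ∈ U)

  extension-choice : ∀ {U θ} → Extension U θ → All (λ v → lookup θ v ∈ₗ candidates U v) free
  extension-choice {U} {θ} (embedding , extends , into-U) = All.tabulate λ {v} v∈free →
    let v∉X = x∈∁p⇒x∉p (members⁻ v∈free) in
    ∈-filter⁺ (candidate? v) (members⁺ (into-U v v∉X)) (embedding-candidate {lookup θ} embedding extends v∉X)

  -- Coding each extension by its choice of candidates, distinct extensions get distinct codes.
  extensions-bound : ∀ U (θs : List (Vec (Fin n) k)) → Unique θs → All (Extension U) θs →
    length θs ≤ product (map (length ∘ candidates U) free)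
  extensions-bound U θs θs-unique extensions = codable⇒length≤ θs-unique code faithful
    where
    code : ∀ {θ} → θ ∈ₗ θs → Fin (product (map (length ∘ candidates U) free))
    code {θ} θ∈ = encode (candidates U) (lookup θ) free (extension-choice {U} {θ} (All.lookup extensions θ∈))
    faithful : ∀ {θ θ′} (θ∈ : θ ∈ₗ θs) (θ′∈ : θ′ ∈ₗ θs) → code θ∈ ≡ code θ′∈ → θ ≡ θ′
    faithful {θ} {θ′} θ∈ θ′∈ same-code = lookup-extensional θ θ′ same-image
      where
      agree-on-free : All (λ v → lookup θ v ≡ lookup θ′ v) free
      agree-on-free = encode-injective (candidates U) (lookup θ) (lookup θ′) free _ _ same-code
      same-image : ∀ v → lookup θ v ≡ lookup θ′ v
      same-image v with v ∈? X
      ... | yes v∈X = trans (proj₁ (proj₂ (All.lookup extensions θ∈)) v v∈X)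
                            (sym (proj₁ (proj₂ (All.lookup extensions θ′∈)) v v∈X))
      ... | no v∉X = All.lookup agree-on-free (members⁺ (x∉p⇒x∈∁p v∉X))

lemma3p8 : ∀ {k n : ℕ} (H : Graph k) (Γ : Graph n) (U : Subset n) (X : Subset k)
    → IsSignature H X
    → (f : (v : Fin k) → v ∈ X → Fin n)
    → (θs : List (Vec (Fin n) k))
    → Unique θs
    → All (λ θ → IsEmbedding H Γ (lookup θ)
    × (∀ (v : Fin k) (p : v ∈ X) → lookup θ v ≡ f v p)
    × (∀ (v : Fin k) → v ∉ X → lookup θ v ∈ U)) θs
    → length θs ≤ E (k ∸ ∣ X ∣) ∣ U ∣
lemma3p8 {k} H Γ U X signature f θs θs-unique extensions = begin
  length θs                                    ≤⟨ extensions-bound U θs θs-unique extensions ⟩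
  product sizes                                ≤⟨ product≤E sizes ∣ U ∣ (candidates-total signature U) ⟩
  E (length sizes) ∣ U ∣                       ≡⟨ cong (λ ℓ → E ℓ ∣ U ∣) (trans (length-map _ free) free-length) ⟩
  E (k ∸ ∣ X ∣) ∣ U ∣                          ∎
  where
  open Candidates H Γ X f
  open ≤-Reasoning
  sizes : List ℕ
  sizes = map (length ∘ candidates U) free
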